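{- An element $g\in F_2$ belongs to the image $\mathrm{Pal}(F_2)$ if and only if $abg$ and $bag$ are conjugate in $F_2$.
   Context: $F_2$ is the free group on $a,b$. $w\mapsto R_w$ is the group homomorphism $F_2\to\mathrm{Aut}(F_2)$ with $R_a(a)=a$, $R_a(b)=ba$, $R_b(a)=ab$, $R_b(b)=b$. The palindromization map $\mathrm{Pal}:F_2\to F_2$ is defined by $\mathrm{Pal}(w)=b^{ -1}a^{ -1}R_w(ab)$. -}

module Defs where

open import Data.List using (List; []; _∷_; _++_; foldr; reverse; map; concatMap)
open import Data.Product using (Σ; ∃; _,_)
open import Relation.Binary.PropositionalEquality using (_≡_)

data Letter : Set where
  a b a⁻ b⁻ : Letter

-- Elements of F₂ are represented by words; two words denote the same
-- element iff their free reductions coincide (relation _≈_ below).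
Word : Set
Word = List Letter

inv : Letter → Letter
inv a = a⁻
inv b = b⁻
inv a⁻ = a
inv b⁻ = b

push : Letter → Word → Word
push a (a⁻ ∷ w) = w
push a⁻ (a ∷ w) = w
push b (b⁻ ∷ w) = w
push b⁻ (b ∷ w) = w
push x w = x ∷ w

reduce : Word → Word
reduce = foldr push []

infix 4 _≈_
_≈_ : Word → Word → Set
u ≈ v = reduce u ≡ reduce v

winv : Word → Word
winv w = reverse (map inv w)

-- the homomorphism extending an assignment of images to the generators
-- (images of inverse letters are the inverses of the images)
extend : (Letter → Word) → Word → Word
extend σ = concatMap σ

σRa : Letter → Word
σRa a = a ∷ []
σRa b = b ∷ a ∷ []
σRa a⁻ = a⁻ ∷ []
σRa b⁻ = a⁻ ∷ b⁻ ∷ []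

σRa⁻¹ : Letter → Word
σRa⁻¹ a = a ∷ []
σRa⁻¹ b = b ∷ a⁻ ∷ []
σRa⁻¹ a⁻ = a⁻ ∷ []
σRa⁻¹ b⁻ = a ∷ b⁻ ∷ []

σRb : Letter → Word
σRb a = a ∷ b ∷ []
σRb b = b ∷ []
σRb a⁻ = b⁻ ∷ a⁻ ∷ []
σRb b⁻ = b⁻ ∷ []

σRb⁻¹ : Letter → Word
σRb⁻¹ a = a ∷ b⁻ ∷ []
σRb⁻¹ b = b ∷ []
σRb⁻¹ a⁻ = b ∷ a⁻ ∷ []
σRb⁻¹ b⁻ = b⁻ ∷ []

Rl : Letter → Word → Word
Rl a = extend σRa
Rl b = extend σRb
Rl a⁻ = extend σRa⁻¹
Rl b⁻ = extend σRb⁻¹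

R : Word → Word → Word
R [] u = u
R (x ∷ w) u = Rl x (R w u)

Pal : Word → Word
Pal w = b⁻ ∷ a⁻ ∷ R w (a ∷ b ∷ [])

Conjugate : Word → Word → Set
Conjugate u v = Σ Word λ h → (h ++ u ++ winv h) ≈ v

InPalImage : Word → Set
InPalImage g = Σ Word λ w → Pal w ≈ g

module Submission where

-- Both directions rest on the fact that every R_w fixes the commutator
-- [b,a] = b a b⁻¹ a⁻¹.  (⇒) If g = Pal(w) then a b g = R_w(ab), and
-- conjugating by R_w(b) turns it into R_w(ba) = R_w([b,a] a b) = b a g.
-- (⇐) If h (abg) h⁻¹ = bag then the pair (h , abg) has commutator
-- bag (abg)⁻¹ = [b,a].  By Nielsen reduction every such pair is
-- (R_w(b) , R_w(a)) for some w, and then g = Pal(w b⁻¹).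

open import Defs
open import Data.Bool using (Bool; T; true; not; _∧_; _∨_)
open import Data.Bool.Properties using (T-∧; T-∨; T-≡)
open import Data.Empty using (⊥-elim)
open import Data.List using ([]; _∷_; _++_; length; map; foldr)
open import Data.List.Properties
  using (++-assoc; ++-identityʳ; ∷-injective; ∷-injectiveʳ; foldr-++; unfold-reverse; reverse-++;
         map-++; length-reverse; length-map; length-++; concatMap-++; ≡-dec)
open import Data.Nat using (ℕ; zero; suc; _+_; _≤_; _<_; _<?_; s≤s; s≤s⁻¹)
open import Data.Nat.Properties
  using (≤-refl; ≤-trans; ≤-antisym; ≤-total; <-irrefl; <-≤-trans; ≮⇒≥; n≮0; m≤n+m; m≢1+n+m;
         +-comm; +-monoˡ-≤; +-monoʳ-≤; +-mono-≤; +-cancelˡ-≤; +-cancelʳ-≤;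
         module ≤-Reasoning)
open import Data.Nat.Tactic.RingSolver using (solve-∀)
open import Data.Product using (Σ; _×_; _,_; proj₁; proj₂)
open import Data.Sum using (_⊎_; inj₁; inj₂)
open import Data.Unit using (⊤; tt)
open import Function.Bundles using (_⇔_; mk⇔; Equivalence)
open import Relation.Binary using (DecidableEquality)
open import Relation.Binary.PropositionalEquality
open import Relation.Nullary using (¬_; Dec; yes; no)
open import Relation.Nullary.Decidable using (isYes; isNo; toWitness; fromWitness; fromWitnessFalse)

inv-involutive : ∀ x → inv (inv x) ≡ x
inv-involutive a = refl
inv-involutive b = refl
inv-involutive a⁻ = refl
inv-involutive b⁻ = refl

Reduced : Word → Set
Reduced [] = ⊤
Reduced (x ∷ []) = ⊤
Reduced (x ∷ y ∷ w) = y ≢ inv x × Reduced (y ∷ w)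

Reduced-tail : ∀ {x w} → Reduced (x ∷ w) → Reduced w
Reduced-tail {w = []} _ = tt
Reduced-tail {w = _ ∷ _} (_ , r) = r

push-nil : ∀ x → push x [] ≡ x ∷ []
push-nil a = refl
push-nil b = refl
push-nil a⁻ = refl
push-nil b⁻ = refl

push-cancel : ∀ x w → push x (inv x ∷ w) ≡ w
push-cancel a w = refl
push-cancel b w = refl
push-cancel a⁻ w = refl
push-cancel b⁻ w = refl

push-cases : ∀ x y w → y ≡ inv x ⊎ (y ≢ inv x × push x (y ∷ w) ≡ x ∷ y ∷ w)
push-cases a a w = inj₂ ((λ ()) , refl)
push-cases a b w = inj₂ ((λ ()) , refl)
push-cases a a⁻ w = inj₁ refl
push-cases a b⁻ w = inj₂ ((λ ()) , refl)
push-cases b a w = inj₂ ((λ ()) , refl)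
push-cases b b w = inj₂ ((λ ()) , refl)
push-cases b a⁻ w = inj₂ ((λ ()) , refl)
push-cases b b⁻ w = inj₁ refl
push-cases a⁻ a w = inj₁ refl
push-cases a⁻ b w = inj₂ ((λ ()) , refl)
push-cases a⁻ a⁻ w = inj₂ ((λ ()) , refl)
push-cases a⁻ b⁻ w = inj₂ ((λ ()) , refl)
push-cases b⁻ a w = inj₂ ((λ ()) , refl)
push-cases b⁻ b w = inj₁ refl
push-cases b⁻ a⁻ w = inj₂ ((λ ()) , refl)
push-cases b⁻ b⁻ w = inj₂ ((λ ()) , refl)

-- Letters are equal exactly when one cancels against the inverse of the other.
_≟ₗ_ : DecidableEquality Letter
x ≟ₗ y with push-cases (inv x) y []
... | inj₁ y≡x⁻⁻ = yes (sym (trans y≡x⁻⁻ (inv-involutive x)))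
... | inj₂ (y≢x⁻⁻ , _) = no λ x≡y → y≢x⁻⁻ (trans (sym x≡y) (sym (inv-involutive x)))

push-onto-reduced : ∀ x w → Reduced (x ∷ w) → push x w ≡ x ∷ w
push-onto-reduced x [] _ = push-nil x
push-onto-reduced x (y ∷ w) (y≢x⁻ , _) with push-cases x y w
... | inj₁ y≡x⁻ = ⊥-elim (y≢x⁻ y≡x⁻)
... | inj₂ (_ , pushed) = pushed

push-reduced : ∀ x w → Reduced w → Reduced (push x w)
push-reduced x [] _ rewrite push-nil x = tt
push-reduced x (y ∷ w) r with push-cases x y w
... | inj₁ refl rewrite push-cancel x w = Reduced-tail r
... | inj₂ (y≢x⁻ , pushed) rewrite pushed = y≢x⁻ , r

reduce-reduced : ∀ w → Reduced (reduce w)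
reduce-reduced [] = tt
reduce-reduced (x ∷ w) = push-reduced x (reduce w) (reduce-reduced w)

reduced-fixed : ∀ w → Reduced w → reduce w ≡ w
reduced-fixed [] _ = refl
reduced-fixed (x ∷ w) r =
  trans (cong (push x) (reduced-fixed w (Reduced-tail r))) (push-onto-reduced x w r)

push-inv-push : ∀ x w → Reduced w → push x (push (inv x) w) ≡ w
push-inv-push x [] _ rewrite push-nil (inv x) = push-cancel x []
push-inv-push x (y ∷ w) r with push-cases (inv x) y w
... | inj₂ (_ , pushed) rewrite pushed = push-cancel x (y ∷ w)
... | inj₁ refl rewrite push-cancel (inv x) w | inv-involutive x = push-onto-reduced x w r

reduce-push-++ : ∀ x p r → reduce (push x p ++ r) ≡ push x (reduce (p ++ r))
reduce-push-++ x [] r rewrite push-nil x = refl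
reduce-push-++ x (y ∷ p) r with push-cases x y p
... | inj₁ refl rewrite push-cancel x p =
  sym (push-inv-push x (reduce (p ++ r)) (reduce-reduced (p ++ r)))
... | inj₂ (_ , pushed) rewrite pushed = refl

foldr-push : ∀ u r → Reduced r → foldr push r u ≡ reduce (reduce u ++ r)
foldr-push [] r rr = sym (reduced-fixed r rr)
foldr-push (x ∷ u) r rr rewrite foldr-push u r rr = sym (reduce-push-++ x (reduce u) r)

reduce-++ : ∀ u v → reduce (u ++ v) ≡ reduce (reduce u ++ reduce v)
reduce-++ u v = trans (foldr-++ push [] u v) (foldr-push u (reduce v) (reduce-reduced v))

≈-reduce : ∀ w → reduce w ≈ w
≈-reduce w = reduced-fixed (reduce w) (reduce-reduced w)

≈-++ : ∀ u u' v v' → u ≈ u' → v ≈ v' → (u ++ v) ≈ (u' ++ v')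
≈-++ u u' v v' u≈u' v≈v' rewrite reduce-++ u v | reduce-++ u' v' | u≈u' | v≈v' = refl

≈-++ˡ : ∀ w u v → u ≈ v → (w ++ u) ≈ (w ++ v)
≈-++ˡ w u v = ≈-++ w w u v refl

≈-++ʳ : ∀ w u v → u ≈ v → (u ++ w) ≈ (v ++ w)
≈-++ʳ w u v u≈v = ≈-++ u v w w u≈v refl

winv-∷ : ∀ x w → winv (x ∷ w) ≡ winv w ++ inv x ∷ []
winv-∷ x w = unfold-reverse (inv x) (map inv w)

winv-++ : ∀ u v → winv (u ++ v) ≡ winv v ++ winv u
winv-++ u v rewrite map-++ inv u v = reverse-++ (map inv u) (map inv v)

winv-involutive : ∀ w → winv (winv w) ≡ w
winv-involutive [] = refl
winv-involutive (x ∷ w) = begin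
  winv (winv (x ∷ w))                ≡⟨ cong winv (winv-∷ x w) ⟩
  winv (winv w ++ inv x ∷ [])        ≡⟨ winv-++ (winv w) (inv x ∷ []) ⟩
  inv (inv x) ∷ winv (winv w)        ≡⟨ cong₂ _∷_ (inv-involutive x) (winv-involutive w) ⟩
  x ∷ w                              ∎
  where open ≡-Reasoning

length-winv : ∀ w → length (winv w) ≡ length w
length-winv w = trans (length-reverse (map inv w)) (length-map inv w)

++-winv : ∀ w → (w ++ winv w) ≈ []
++-winv [] = refl
++-winv (x ∷ w) = begin
  push x (reduce (w ++ winv (x ∷ w)))            ≡⟨ cong (λ z → push x (reduce z)) reassoc ⟩
  push x (reduce ((w ++ winv w) ++ inv x ∷ []))  ≡⟨ cong (push x) (≈-++ʳ (inv x ∷ []) (w ++ winv w) [] (++-winv w)) ⟩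
  push x (push (inv x) [])                       ≡⟨ cong (push x) (push-nil (inv x)) ⟩
  push x (inv x ∷ [])                            ≡⟨ push-cancel x [] ⟩
  []                                             ∎
  where
  open ≡-Reasoning
  reassoc : w ++ winv (x ∷ w) ≡ (w ++ winv w) ++ inv x ∷ []
  reassoc = trans (cong (w ++_) (winv-∷ x w)) (sym (++-assoc w (winv w) (inv x ∷ [])))

cancel : ∀ x u y → (x ++ u ++ winv u ++ y) ≈ (x ++ y)
cancel x u y = ≈-++ˡ x (u ++ winv u ++ y) y (begin
  reduce (u ++ winv u ++ y)    ≡⟨ cong reduce (sym (++-assoc u (winv u) y)) ⟩
  reduce ((u ++ winv u) ++ y)  ≡⟨ ≈-++ʳ y (u ++ winv u) [] (++-winv u) ⟩
  reduce y                     ∎)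
  where open ≡-Reasoning

cancel' : ∀ x u y → (x ++ winv u ++ u ++ y) ≈ (x ++ y)
cancel' x u y =
  subst (λ z → (x ++ winv u ++ z ++ y) ≈ (x ++ y)) (winv-involutive u) (cancel x (winv u) y)

seam : ∀ X s Y → ((X ++ s) ++ winv s ++ Y) ≈ (X ++ Y)
seam X s Y = trans (cong reduce (++-assoc X s (winv s ++ Y))) (cancel X s Y)

cancel-right : ∀ X Y → ((X ++ Y) ++ winv Y) ≈ X
cancel-right X Y = begin
  reduce ((X ++ Y) ++ winv Y)       ≡⟨ cong (λ z → reduce ((X ++ Y) ++ z)) (sym (++-identityʳ (winv Y))) ⟩
  reduce ((X ++ Y) ++ winv Y ++ [])  ≡⟨ seam X Y [] ⟩
  reduce (X ++ [])                   ≡⟨ cong reduce (++-identityʳ X) ⟩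
  reduce X                           ∎
  where open ≡-Reasoning

cancel-right' : ∀ X Y → ((X ++ winv Y) ++ Y) ≈ X
cancel-right' X Y =
  subst (λ z → ((X ++ winv Y) ++ z) ≈ X) (winv-involutive Y) (cancel-right X (winv Y))

inverse-unique : ∀ p q → (p ++ q) ≈ [] → q ≈ winv p
inverse-unique p q pq≈[] = begin
  reduce q                     ≡⟨ sym (cancel' [] p q) ⟩
  reduce (winv p ++ p ++ q)    ≡⟨ ≈-++ˡ (winv p) (p ++ q) [] pq≈[] ⟩
  reduce (winv p ++ [])        ≡⟨ cong reduce (++-identityʳ (winv p)) ⟩
  reduce (winv p)              ∎
  where open ≡-Reasoning

winv-resp : ∀ u v → u ≈ v → winv u ≈ winv v
winv-resp u v u≈v =
  inverse-unique v (winv u) (trans (≈-++ʳ (winv u) v u (sym u≈v)) (++-winv u))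

Reduced-++ˡ : ∀ x y → Reduced (x ++ y) → Reduced x
Reduced-++ˡ [] y r = tt
Reduced-++ˡ (e ∷ []) y r = tt
Reduced-++ˡ (e ∷ f ∷ x) y (f≢e⁻ , r) = f≢e⁻ , Reduced-++ˡ (f ∷ x) y r

Reduced-++ʳ : ∀ x y → Reduced (x ++ y) → Reduced y
Reduced-++ʳ [] y r = r
Reduced-++ʳ (e ∷ x) y r = Reduced-++ʳ x y (Reduced-tail r)

Reduced-infix : ∀ p m q → Reduced (p ++ m ++ q) → Reduced m
Reduced-infix p m q r = Reduced-++ˡ m q (Reduced-++ʳ p (m ++ q) r)

Reduced-glue : ∀ p q r → Reduced (p ++ q) → Reduced (q ++ r) → q ≢ [] → Reduced (p ++ q ++ r)
Reduced-glue [] q r _ rqr _ = rqr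
Reduced-glue (e ∷ []) [] r _ _ q≢[] = ⊥-elim (q≢[] refl)
Reduced-glue (e ∷ []) (y ∷ q) r (y≢e⁻ , _) rqr _ = y≢e⁻ , rqr
Reduced-glue (e ∷ f ∷ p) q r (f≢e⁻ , rpq) rqr q≢[] = f≢e⁻ , Reduced-glue (f ∷ p) q r rpq rqr q≢[]

Reduced-winv : ∀ w → Reduced w → Reduced (winv w)
Reduced-winv [] _ = tt
Reduced-winv (x ∷ []) _ = tt
Reduced-winv (x ∷ y ∷ w) (y≢x⁻ , r) =
  subst Reduced (sym shape)
    (Reduced-glue (winv w) (inv y ∷ []) (inv x ∷ [])
      (subst Reduced (winv-∷ y w) (Reduced-winv (y ∷ w) r)) (x⁻≢y⁻⁻ , tt) (λ ()))
  where
  shape : winv (x ∷ y ∷ w) ≡ winv w ++ inv y ∷ inv x ∷ []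
  shape = trans (winv-∷ x (y ∷ w))
            (trans (cong (_++ inv x ∷ []) (winv-∷ y w)) (++-assoc (winv w) (inv y ∷ []) (inv x ∷ [])))
  x⁻≢y⁻⁻ : inv x ≢ inv (inv y)
  x⁻≢y⁻⁻ e = y≢x⁻ (sym (trans e (inv-involutive y)))

not-reduced-inv-self : ∀ s → s ≢ [] → ¬ Reduced (winv s ++ s)
not-reduced-inv-self [] s≢[] _ = s≢[] refl
not-reduced-inv-self (x ∷ s) _ r = proj₁ (Reduced-++ʳ (winv s) (inv x ∷ x ∷ s) (subst Reduced shape r))
                                         (sym (inv-involutive x))
  where
  shape : winv (x ∷ s) ++ x ∷ s ≡ winv s ++ inv x ∷ x ∷ s
  shape = trans (cong (_++ x ∷ s) (winv-∷ x s)) (++-assoc (winv s) (inv x ∷ []) (x ∷ s))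

length-reduce-winv : ∀ w → length (reduce (winv w)) ≡ length (reduce w)
length-reduce-winv w = begin
  length (reduce (winv w))             ≡⟨ cong length (winv-resp w (reduce w) (sym (≈-reduce w))) ⟩
  length (reduce (winv (reduce w)))    ≡⟨ cong length (reduced-fixed _ (Reduced-winv _ (reduce-reduced w))) ⟩
  length (winv (reduce w))             ≡⟨ length-winv (reduce w) ⟩
  length (reduce w)                    ∎
  where open ≡-Reasoning

InverseCompatible : (Letter → Word) → Set
InverseCompatible σ = ∀ x → σ (inv x) ≈ winv (σ x)

extend-push : ∀ σ → InverseCompatible σ → ∀ x r → extend σ (x ∷ r) ≈ extend σ (push x r)
extend-push σ σ-inv x [] rewrite push-nil x = refl
extend-push σ σ-inv x (y ∷ r) with push-cases x y r
... | inj₂ (_ , pushed) rewrite pushed = refl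
... | inj₁ refl rewrite push-cancel x r = begin
  reduce (σ x ++ σ (inv x) ++ extend σ r)   ≡⟨ ≈-++ˡ (σ x) _ _ (≈-++ʳ (extend σ r) (σ (inv x)) (winv (σ x)) (σ-inv x)) ⟩
  reduce (σ x ++ winv (σ x) ++ extend σ r)  ≡⟨ cancel [] (σ x) (extend σ r) ⟩
  reduce (extend σ r)                       ∎
  where open ≡-Reasoning

extend-reduce : ∀ σ → InverseCompatible σ → ∀ w → extend σ w ≈ extend σ (reduce w)
extend-reduce σ σ-inv [] = refl
extend-reduce σ σ-inv (x ∷ w) =
  trans (≈-++ˡ (σ x) (extend σ w) (extend σ (reduce w)) (extend-reduce σ σ-inv w))
        (extend-push σ σ-inv x (reduce w))

extend-resp : ∀ σ → InverseCompatible σ → ∀ u v → u ≈ v → extend σ u ≈ extend σ v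
extend-resp σ σ-inv u v u≈v =
  trans (extend-reduce σ σ-inv u) (trans (cong (λ z → reduce (extend σ z)) u≈v) (sym (extend-reduce σ σ-inv v)))

Rl-resp : ∀ x u v → u ≈ v → Rl x u ≈ Rl x v
Rl-resp a = extend-resp σRa λ { a → refl ; b → refl ; a⁻ → refl ; b⁻ → refl }
Rl-resp b = extend-resp σRb λ { a → refl ; b → refl ; a⁻ → refl ; b⁻ → refl }
Rl-resp a⁻ = extend-resp σRa⁻¹ λ { a → refl ; b → refl ; a⁻ → refl ; b⁻ → refl }
Rl-resp b⁻ = extend-resp σRb⁻¹ λ { a → refl ; b → refl ; a⁻ → refl ; b⁻ → refl }

Rl-++ : ∀ x u v → Rl x (u ++ v) ≡ Rl x u ++ Rl x v
Rl-++ a = concatMap-++ σRa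
Rl-++ b = concatMap-++ σRb
Rl-++ a⁻ = concatMap-++ σRa⁻¹
Rl-++ b⁻ = concatMap-++ σRb⁻¹

R-resp : ∀ w u v → u ≈ v → R w u ≈ R w v
R-resp [] u v u≈v = u≈v
R-resp (x ∷ w) u v u≈v = Rl-resp x (R w u) (R w v) (R-resp w u v u≈v)

R-++ : ∀ w u v → R w (u ++ v) ≡ R w u ++ R w v
R-++ [] u v = refl
R-++ (x ∷ w) u v rewrite R-++ w u v = Rl-++ x (R w u) (R w v)

Rl-nil : ∀ x → Rl x [] ≡ []
Rl-nil a = refl
Rl-nil b = refl
Rl-nil a⁻ = refl
Rl-nil b⁻ = refl

R-nil : ∀ w → R w [] ≡ []
R-nil [] = refl
R-nil (x ∷ w) = trans (cong (Rl x) (R-nil w)) (Rl-nil x)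

R-snoc : ∀ w x u → R (w ++ x ∷ []) u ≡ R w (Rl x u)
R-snoc [] x u = refl
R-snoc (y ∷ w) x u rewrite R-snoc w x u = refl

R-winv : ∀ w u → R w (winv u) ≈ winv (R w u)
R-winv w u = inverse-unique (R w u) (R w (winv u)) (begin
  reduce (R w u ++ R w (winv u))   ≡⟨ cong reduce (sym (R-++ w u (winv u))) ⟩
  reduce (R w (u ++ winv u))       ≡⟨ R-resp w (u ++ winv u) [] (++-winv u) ⟩
  reduce (R w [])                  ≡⟨ cong reduce (R-nil w) ⟩
  []                               ∎)
  where open ≡-Reasoning

[b,a] : Word
[b,a] = b ∷ a ∷ b⁻ ∷ a⁻ ∷ []

Rl-fixes-[b,a] : ∀ x → Rl x [b,a] ≈ [b,a]
Rl-fixes-[b,a] a = refl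
Rl-fixes-[b,a] b = refl
Rl-fixes-[b,a] a⁻ = refl
Rl-fixes-[b,a] b⁻ = refl

R-fixes-[b,a] : ∀ w → R w [b,a] ≈ [b,a]
R-fixes-[b,a] [] = refl
R-fixes-[b,a] (x ∷ w) = trans (Rl-resp x (R w [b,a]) [b,a] (R-fixes-[b,a] w)) (Rl-fixes-[b,a] x)

-- If Pal w ≈ g, i.e. a b g ≈ R_w(ab), then conjugation by R_w(b) sends
-- a b g to R_w(b a b b⁻¹) = R_w(ba) = R_w([b,a] a b) ≈ b a g.
conjugation-by-image-of-b : ∀ w g → Pal w ≈ g →
  (R w (b ∷ []) ++ (a ∷ b ∷ g) ++ winv (R w (b ∷ []))) ≈ (b ∷ a ∷ g)
conjugation-by-image-of-b w g Pal-w≈g = trans conjugate≈Rba (sym bag≈Rba)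
  where
  open ≡-Reasoning
  Rb : Word
  Rb = R w (b ∷ [])
  Rab : Word
  Rab = R w (a ∷ b ∷ [])
  abg≈Rab : (a ∷ b ∷ g) ≈ Rab
  abg≈Rab = trans (≈-++ˡ (a ∷ b ∷ []) g (Pal w) (sym Pal-w≈g)) (cancel [] (a ∷ b ∷ []) Rab)
  conjugate≈Rba : (Rb ++ (a ∷ b ∷ g) ++ winv Rb) ≈ R w (b ∷ a ∷ [])
  conjugate≈Rba = begin
    reduce (Rb ++ (a ∷ b ∷ g) ++ winv Rb)
      ≡⟨ ≈-++ˡ Rb _ _ (≈-++ (a ∷ b ∷ g) Rab (winv Rb) (R w (b⁻ ∷ [])) abg≈Rab (sym (R-winv w (b ∷ [])))) ⟩
    reduce (Rb ++ Rab ++ R w (b⁻ ∷ []))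
      ≡⟨ cong (λ z → reduce (Rb ++ z)) (sym (R-++ w (a ∷ b ∷ []) (b⁻ ∷ []))) ⟩
    reduce (Rb ++ R w (a ∷ b ∷ b⁻ ∷ []))
      ≡⟨ cong reduce (sym (R-++ w (b ∷ []) (a ∷ b ∷ b⁻ ∷ []))) ⟩
    reduce (R w (b ∷ a ∷ b ∷ b⁻ ∷ []))
      ≡⟨ R-resp w (b ∷ a ∷ b ∷ b⁻ ∷ []) (b ∷ a ∷ []) refl ⟩
    reduce (R w (b ∷ a ∷ [])) ∎
  bag≈Rba : (b ∷ a ∷ g) ≈ R w (b ∷ a ∷ [])
  bag≈Rba = begin
    reduce (b ∷ a ∷ g)             ≡⟨ ≈-++ˡ (b ∷ a ∷ []) g (Pal w) (sym Pal-w≈g) ⟩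
    reduce ([b,a] ++ Rab)          ≡⟨ ≈-++ʳ Rab [b,a] (R w [b,a]) (sym (R-fixes-[b,a] w)) ⟩
    reduce (R w [b,a] ++ Rab)      ≡⟨ cong reduce (sym (R-++ w [b,a] (a ∷ b ∷ []))) ⟩
    reduce (R w ([b,a] ++ a ∷ b ∷ []))  ≡⟨ R-resp w ([b,a] ++ a ∷ b ∷ []) (b ∷ a ∷ []) refl ⟩
    reduce (R w (b ∷ a ∷ []))      ∎

commutator : Word → Word → Word
commutator H U = H ++ U ++ winv H ++ winv U

commutator-resp : ∀ H H' U U' → H ≈ H' → U ≈ U' → commutator H U ≈ commutator H' U'
commutator-resp H H' U U' H≈H' U≈U' =
  ≈-++ H H' _ _ H≈H' (≈-++ U U' _ _ U≈U'
    (≈-++ (winv H) (winv H') _ _ (winv-resp H H' H≈H') (winv-resp U U' U≈U')))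

commutator-of-conjugate : ∀ h u v → (h ++ u ++ winv h) ≈ v → commutator h u ≈ (v ++ winv u)
commutator-of-conjugate h u v conj = begin
  reduce (h ++ u ++ winv h ++ winv u)    ≡⟨ cong reduce reassoc ⟩
  reduce ((h ++ u ++ winv h) ++ winv u)  ≡⟨ ≈-++ʳ (winv u) (h ++ u ++ winv h) v conj ⟩
  reduce (v ++ winv u)                   ∎
  where
  open ≡-Reasoning
  reassoc : h ++ u ++ winv h ++ winv u ≡ (h ++ u ++ winv h) ++ winv u
  reassoc = sym (trans (++-assoc h (u ++ winv h) (winv u)) (cong (h ++_) (++-assoc u (winv h) (winv u))))

bag-abg⁻¹ : ∀ g → ((b ∷ a ∷ g) ++ winv (a ∷ b ∷ g)) ≈ [b,a]
bag-abg⁻¹ g = trans (cong (λ z → reduce (b ∷ a ∷ g ++ z)) (winv-++ (a ∷ b ∷ []) g))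
                    (cancel (b ∷ a ∷ []) g (b⁻ ∷ a⁻ ∷ []))

ImagePair : Word → Word → Set
ImagePair H U = Σ Word λ w → R w (b ∷ []) ≈ H × R w (a ∷ []) ≈ U

ImagePair-resp : ∀ H H' U U' → H ≈ H' → U ≈ U' → ImagePair H U → ImagePair H' U'
ImagePair-resp H H' U U' H≈H' U≈U' (w , Rb≈H , Ra≈U) = w , trans Rb≈H H≈H' , trans Ra≈U U≈U'

image-of-two-letters : ∀ w y z Y Z → R w (y ∷ []) ≈ Y → R w (z ∷ []) ≈ Z → R w (y ∷ z ∷ []) ≈ (Y ++ Z)
image-of-two-letters w y z Y Z Ry≈Y Rz≈Z =
  trans (cong reduce (R-++ w (y ∷ []) (z ∷ []))) (≈-++ (R w (y ∷ [])) Y (R w (z ∷ [])) Z Ry≈Y Rz≈Z)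

image-of-inverse : ∀ w y Y → R w (y ∷ []) ≈ Y → R w (inv y ∷ []) ≈ winv Y
image-of-inverse w y Y Ry≈Y = trans (R-winv w (y ∷ [])) (winv-resp (R w (y ∷ [])) Y Ry≈Y)

snoc-image : ∀ w x u V → R w (Rl x u) ≈ V → R (w ++ x ∷ []) u ≈ V
snoc-image w x u V Rw-Rx-u≈V = trans (cong reduce (R-snoc w x u)) Rw-Rx-u≈V

-- If R_w(a) ≈ a b g then Pal(w b⁻¹) = b⁻¹a⁻¹ R_w(R_b⁻¹(ab)) = b⁻¹a⁻¹ R_w(a) ≈ g.
pal-from-image-of-a : ∀ w g → R w (a ∷ []) ≈ (a ∷ b ∷ g) → Pal (w ++ b⁻ ∷ []) ≈ g
pal-from-image-of-a w g Ra≈abg = begin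
  reduce (b⁻ ∷ a⁻ ∷ R (w ++ b⁻ ∷ []) (a ∷ b ∷ []))  ≡⟨ cong (λ z → reduce (b⁻ ∷ a⁻ ∷ z)) (R-snoc w b⁻ (a ∷ b ∷ [])) ⟩
  reduce (b⁻ ∷ a⁻ ∷ R w (a ∷ b⁻ ∷ b ∷ []))         ≡⟨ ≈-++ˡ (b⁻ ∷ a⁻ ∷ []) (R w (a ∷ b⁻ ∷ b ∷ [])) (R w (a ∷ [])) (R-resp w (a ∷ b⁻ ∷ b ∷ []) (a ∷ []) refl) ⟩
  reduce (b⁻ ∷ a⁻ ∷ R w (a ∷ []))                  ≡⟨ ≈-++ˡ (b⁻ ∷ a⁻ ∷ []) (R w (a ∷ [])) (a ∷ b ∷ g) Ra≈abg ⟩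
  reduce (b⁻ ∷ a⁻ ∷ a ∷ b ∷ g)                     ≡⟨ cancel [] (b⁻ ∷ a⁻ ∷ []) g ⟩
  reduce g                                         ∎
  where open ≡-Reasoning

commutator-H∙U : ∀ H U → commutator (H ++ U) U ≈ commutator H U
commutator-H∙U H U = begin
  reduce ((H ++ U) ++ U ++ winv (H ++ U) ++ winv U)         ≡⟨ cong (λ z → reduce ((H ++ U) ++ U ++ z ++ winv U)) (winv-++ H U) ⟩
  reduce ((H ++ U) ++ U ++ (winv U ++ winv H) ++ winv U)    ≡⟨ cong (λ z → reduce ((H ++ U) ++ U ++ z)) (++-assoc (winv U) (winv H) (winv U)) ⟩
  reduce ((H ++ U) ++ U ++ winv U ++ winv H ++ winv U)      ≡⟨ cancel (H ++ U) U (winv H ++ winv U) ⟩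
  reduce ((H ++ U) ++ winv H ++ winv U)                     ≡⟨ cong reduce (++-assoc H U _) ⟩
  reduce (commutator H U)                                   ∎
  where open ≡-Reasoning

commutator-H∙U⁻¹ : ∀ H U → commutator (H ++ winv U) U ≈ commutator H U
commutator-H∙U⁻¹ H U = begin
  reduce ((H ++ winv U) ++ U ++ winv (H ++ winv U) ++ winv U)  ≡⟨ cong (λ z → reduce ((H ++ winv U) ++ U ++ z ++ winv U)) inverse ⟩
  reduce ((H ++ winv U) ++ U ++ (U ++ winv H) ++ winv U)       ≡⟨ cong reduce (++-assoc H (winv U) _) ⟩
  reduce (H ++ winv U ++ U ++ (U ++ winv H) ++ winv U)         ≡⟨ cancel' H U _ ⟩
  reduce (H ++ (U ++ winv H) ++ winv U)                        ≡⟨ cong (λ z → reduce (H ++ z)) (++-assoc U (winv H) (winv U)) ⟩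
  reduce (commutator H U)                                      ∎
  where
  open ≡-Reasoning
  inverse : winv (H ++ winv U) ≡ U ++ winv H
  inverse = trans (winv-++ H (winv U)) (cong (_++ winv H) (winv-involutive U))

commutator-U∙H : ∀ H U → commutator H (U ++ H) ≈ commutator H U
commutator-U∙H H U = begin
  reduce (H ++ (U ++ H) ++ winv H ++ winv (U ++ H))           ≡⟨ cong (λ z → reduce (H ++ (U ++ H) ++ winv H ++ z)) (winv-++ U H) ⟩
  reduce (H ++ (U ++ H) ++ winv H ++ (winv H ++ winv U))      ≡⟨ cong (λ z → reduce (H ++ z)) (++-assoc U H _) ⟩
  reduce (H ++ U ++ H ++ winv H ++ (winv H ++ winv U))        ≡⟨ cong reduce (sym (++-assoc H U _)) ⟩
  reduce ((H ++ U) ++ H ++ winv H ++ (winv H ++ winv U))      ≡⟨ cancel (H ++ U) H _ ⟩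
  reduce ((H ++ U) ++ winv H ++ winv U)                       ≡⟨ cong reduce (++-assoc H U _) ⟩
  reduce (commutator H U)                                     ∎
  where open ≡-Reasoning

commutator-U∙H⁻¹ : ∀ H U → commutator H (U ++ winv H) ≈ commutator H U
commutator-U∙H⁻¹ H U = begin
  reduce (H ++ (U ++ winv H) ++ winv H ++ winv (U ++ winv H))   ≡⟨ cong (λ z → reduce (H ++ (U ++ winv H) ++ winv H ++ z)) inverse ⟩
  reduce (H ++ (U ++ winv H) ++ winv H ++ (H ++ winv U))        ≡⟨ cong reduce reassoc ⟩
  reduce (((H ++ U) ++ winv H) ++ winv H ++ H ++ winv U)        ≡⟨ cancel' ((H ++ U) ++ winv H) H (winv U) ⟩
  reduce (((H ++ U) ++ winv H) ++ winv U)                       ≡⟨ cong reduce (trans (++-assoc (H ++ U) (winv H) _) (++-assoc H U _)) ⟩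
  reduce (commutator H U)                                       ∎
  where
  open ≡-Reasoning
  inverse : winv (U ++ winv H) ≡ H ++ winv U
  inverse = trans (winv-++ U (winv H)) (cong (_++ winv U) (winv-involutive H))
  reassoc : H ++ (U ++ winv H) ++ winv H ++ (H ++ winv U) ≡ ((H ++ U) ++ winv H) ++ winv H ++ H ++ winv U
  reassoc = trans (cong (H ++_) (++-assoc U (winv H) _))
                  (sym (trans (++-assoc (H ++ U) (winv H) _) (++-assoc H U _)))

data Move : Set where
  H∙U H∙U⁻¹ U∙H U∙H⁻¹ : Move

first : Move → Word → Word → Word
first H∙U H U = reduce (H ++ U)
first H∙U⁻¹ H U = reduce (H ++ winv U)
first U∙H H U = H
first U∙H⁻¹ H U = H

second : Move → Word → Word → Word
second H∙U H U = U
second H∙U⁻¹ H U = U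
second U∙H H U = reduce (U ++ H)
second U∙H⁻¹ H U = reduce (U ++ winv H)

size : Word → Word → ℕ
size H U = length H + length U

move-reduced : ∀ m H U → Reduced H → Reduced U → Reduced (first m H U) × Reduced (second m H U)
move-reduced H∙U H U rH rU = reduce-reduced (H ++ U) , rU
move-reduced H∙U⁻¹ H U rH rU = reduce-reduced (H ++ winv U) , rU
move-reduced U∙H H U rH rU = rH , reduce-reduced (U ++ H)
move-reduced U∙H⁻¹ H U rH rU = rH , reduce-reduced (U ++ winv H)

move-commutator : ∀ m H U → commutator (first m H U) (second m H U) ≈ commutator H U
move-commutator H∙U H U =
  trans (commutator-resp (reduce (H ++ U)) (H ++ U) U U (≈-reduce (H ++ U)) refl) (commutator-H∙U H U)
move-commutator H∙U⁻¹ H U =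
  trans (commutator-resp (reduce (H ++ winv U)) (H ++ winv U) U U (≈-reduce (H ++ winv U)) refl) (commutator-H∙U⁻¹ H U)
move-commutator U∙H H U =
  trans (commutator-resp H H (reduce (U ++ H)) (U ++ H) refl (≈-reduce (U ++ H))) (commutator-U∙H H U)
move-commutator U∙H⁻¹ H U =
  trans (commutator-resp H H (reduce (U ++ winv H)) (U ++ winv H) refl (≈-reduce (U ++ winv H))) (commutator-U∙H⁻¹ H U)

-- Moves are realised by R: if the moved pair is (R_w(b) , R_w(a)), the
-- original pair is the image of (b , a) under R_{w x}, x undoing the move.
move-reflects : ∀ m H U → ImagePair (first m H U) (second m H U) → ImagePair H U
move-reflects H∙U H U (w , Rb≈ , Ra≈U) = w ++ a⁻ ∷ [] , snoc-image w a⁻ (b ∷ []) H Rb≈H , snoc-image w a⁻ (a ∷ []) U Ra≈U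
  where
  Rb≈H : R w (b ∷ a⁻ ∷ []) ≈ H
  Rb≈H = trans (image-of-two-letters w b a⁻ (reduce (H ++ U)) (winv U) Rb≈ (image-of-inverse w a U Ra≈U))
           (trans (≈-++ʳ (winv U) (reduce (H ++ U)) (H ++ U) (≈-reduce (H ++ U))) (cancel-right H U))
move-reflects H∙U⁻¹ H U (w , Rb≈ , Ra≈U) = w ++ a ∷ [] , snoc-image w a (b ∷ []) H Rb≈H , snoc-image w a (a ∷ []) U Ra≈U
  where
  Rb≈H : R w (b ∷ a ∷ []) ≈ H
  Rb≈H = trans (image-of-two-letters w b a (reduce (H ++ winv U)) U Rb≈ Ra≈U)
           (trans (≈-++ʳ U (reduce (H ++ winv U)) (H ++ winv U) (≈-reduce (H ++ winv U))) (cancel-right' H U))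
move-reflects U∙H H U (w , Rb≈H , Ra≈) = w ++ b⁻ ∷ [] , snoc-image w b⁻ (b ∷ []) H Rb≈H , snoc-image w b⁻ (a ∷ []) U Ra≈U
  where
  Ra≈U : R w (a ∷ b⁻ ∷ []) ≈ U
  Ra≈U = trans (image-of-two-letters w a b⁻ (reduce (U ++ H)) (winv H) Ra≈ (image-of-inverse w b H Rb≈H))
           (trans (≈-++ʳ (winv H) (reduce (U ++ H)) (U ++ H) (≈-reduce (U ++ H))) (cancel-right U H))
move-reflects U∙H⁻¹ H U (w , Rb≈H , Ra≈) = w ++ b ∷ [] , snoc-image w b (b ∷ []) H Rb≈H , snoc-image w b (a ∷ []) U Ra≈U
  where
  Ra≈U : R w (a ∷ b ∷ []) ≈ U
  Ra≈U = trans (image-of-two-letters w a b (reduce (U ++ winv H)) H Ra≈ Rb≈H)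
           (trans (≈-++ʳ H (reduce (U ++ winv H)) (U ++ winv H) (≈-reduce (U ++ winv H))) (cancel-right' U H))

Shortens : Move → Word → Word → Set
Shortens m H U = size (first m H U) (second m H U) < size H U

NielsenReduced : Word → Word → Set
NielsenReduced H U = ∀ m → ¬ Shortens m H U

shortens? : ∀ m H U → Dec (Shortens m H U)
shortens? m H U = size (first m H U) (second m H U) <? size H U

nielsen-or-shorter : ∀ H U → NielsenReduced H U ⊎ Σ Move (λ m → Shortens m H U)
nielsen-or-shorter H U
  with shortens? H∙U H U | shortens? H∙U⁻¹ H U | shortens? U∙H H U | shortens? U∙H⁻¹ H U
... | yes s | _ | _ | _ = inj₂ (H∙U , s)
... | no _ | yes s | _ | _ = inj₂ (H∙U⁻¹ , s)
... | no _ | no _ | yes s | _ = inj₂ (U∙H , s)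
... | no _ | no _ | no _ | yes s = inj₂ (U∙H⁻¹ , s)
... | no n₁ | no n₂ | no n₃ | no n₄ = inj₁ λ { H∙U → n₁ ; H∙U⁻¹ → n₂ ; U∙H → n₃ ; U∙H⁻¹ → n₄ }

-- x = x' s and y = s⁻¹ y' with x' y' reduced: the reduced form of x y is x' y'.
record Cancellation (x y : Word) : Set where
  constructor cancellation
  field
    left common right : Word
    left-eq : x ≡ left ++ common
    right-eq : y ≡ winv common ++ right
    reduced : Reduced (left ++ right)

cancel-product : ∀ x y → Reduced x → Reduced y → Cancellation x y
cancel-product [] y _ ry = cancellation [] [] y refl refl ry
cancel-product (e ∷ x) y rx ry with cancel-product x y (Reduced-tail rx) ry
... | cancellation (f ∷ l) s r refl refl rlr = cancellation (e ∷ f ∷ l) s r refl refl (proj₁ rx , rlr)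
... | cancellation [] s [] refl refl _ = cancellation (e ∷ []) s [] refl refl tt
... | cancellation [] s (z ∷ r) refl refl rzr with push-cases e z r
...   | inj₁ refl = cancellation [] (e ∷ s) r refl (sym shape) (Reduced-tail rzr)
  where
  shape : winv (e ∷ s) ++ r ≡ winv s ++ inv e ∷ r
  shape = trans (cong (_++ r) (winv-∷ e s)) (++-assoc (winv s) (inv e ∷ []) r)
...   | inj₂ (z≢e⁻ , _) = cancellation (e ∷ []) s (z ∷ r) refl refl (z≢e⁻ , rzr)

module _ {x y : Word} (C : Cancellation x y) where
  open Cancellation C

  reduce-product : reduce (x ++ y) ≡ left ++ right
  reduce-product rewrite left-eq | right-eq =
    trans (cong reduce (++-assoc left common (winv common ++ right)))
          (trans (cancel left common right) (reduced-fixed (left ++ right) reduced))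

  length-left-factor : length x ≡ length left + length common
  length-left-factor = trans (cong length left-eq) (length-++ left)

  length-right-factor : length y ≡ length common + length right
  length-right-factor =
    trans (cong length right-eq) (trans (length-++ (winv common)) (cong (_+ length right) (length-winv common)))

  non-shortening-left : length x ≤ length (reduce (x ++ y)) → length common ≤ length right
  non-shortening-left x≤xy = +-cancelˡ-≤ (length left) _ _
    (subst₂ _≤_ length-left-factor (trans (cong length reduce-product) (length-++ left)) x≤xy)

  non-shortening-right : length y ≤ length (reduce (x ++ y)) → length common ≤ length left
  non-shortening-right y≤xy = +-cancelʳ-≤ (length right) _ _
    (subst₂ _≤_ length-right-factor (trans (cong length reduce-product) (length-++ left)) y≤xy)

common-middle : ∀ (p y x q : Word) → p ++ y ≡ x ++ q → length p + length q ≤ length (x ++ q) →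
  Σ Word λ m → y ≡ m ++ q × x ≡ p ++ m
common-middle [] y x q py≡xq _ = x , py≡xq , refl
common-middle (e ∷ p) y [] q py≡xq le = ⊥-elim (<-irrefl refl (<-≤-trans (s≤s (m≤n+m (length q) (length p))) le))
common-middle (e ∷ p) y (f ∷ x) q py≡xq (s≤s le) with ∷-injective py≡xq
... | refl , py≡xq' with common-middle p y x q py≡xq' le
...   | m , y≡mq , x≡pm = m , y≡mq , cong (e ∷_) x≡pm

equal-length-suffix : ∀ (xs s ys t : Word) → xs ++ s ≡ ys ++ t → length s ≡ length t → s ≡ t
equal-length-suffix [] s [] t eq _ = eq
equal-length-suffix [] s (y ∷ ys) t eq ls≡lt =
  ⊥-elim (m≢1+n+m (length t) (trans (sym ls≡lt) (trans (cong length eq) (cong suc (length-++ ys)))))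
equal-length-suffix (x ∷ xs) s [] t eq ls≡lt =
  ⊥-elim (m≢1+n+m (length s) (trans ls≡lt (trans (cong length (sym eq)) (cong suc (length-++ xs)))))
equal-length-suffix (x ∷ xs) s (y ∷ ys) t eq ls≡lt = equal-length-suffix xs s ys t (∷-injectiveʳ eq) ls≡lt

double≤ : ∀ {k m n} → n ≡ k + m → k ≤ m → k + k ≤ n
double≤ {k} n≡k+m k≤m = subst (k + k ≤_) (sym n≡k+m) (+-monoʳ-≤ k k≤m)

double≤' : ∀ {k m n} → n ≡ m + k → k ≤ m → k + k ≤ n
double≤' {k} {m} n≡m+k = double≤ (trans n≡m+k (+-comm m k))

half-sum : ∀ m n u → m + m ≤ u → n + n ≤ u → m + n ≤ u
half-sum m n u 2m≤u 2n≤u with ≤-total m n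
... | inj₁ m≤n = ≤-trans (+-monoˡ-≤ n m≤n) 2n≤u
... | inj₂ n≤m = ≤-trans (+-monoʳ-≤ m n≤m) 2m≤u

half-eq : ∀ m n → m + m ≤ m + n → n + n ≤ m + n → m ≡ n
half-eq m n 2m≤ 2n≤ = ≤-antisym (+-cancelˡ-≤ m m n 2m≤) (+-cancelʳ-≤ n n m 2n≤)

equal-halves : ∀ s t → length s + length s ≤ length (winv s ++ t) → length t + length t ≤ length (winv s ++ t) →
  length s ≡ length t
equal-halves s t s-half t-half =
  half-eq (length s) (length t) (subst (length s + length s ≤_) length-s⁻t s-half)
                                (subst (length t + length t ≤_) length-s⁻t t-half)
  where
  length-s⁻t : length (winv s ++ t) ≡ length s + length t
  length-s⁻t = trans (length-++ (winv s)) (cong (_+ length t) (length-winv s))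

-- In a nonempty reduced word V = s⁻¹ M t whose ends s⁻¹ and t are each at most
-- half of V, the middle M is nonempty once s and t are suffixes of one word:
-- otherwise s = t and V = s⁻¹ s could not be reduced.
middle-nonempty : ∀ {V s M t P Q} → Reduced V → V ≢ [] → V ≡ winv s ++ M ++ t →
  length s + length s ≤ length V → length t + length t ≤ length V → P ++ s ≡ Q ++ t → M ≢ []
middle-nonempty {s = s} {t = t} {P = P} {Q = Q} rV V≢[] refl s-half t-half Ps≡Qt refl
  with equal-length-suffix P s Q t Ps≡Qt (equal-halves s t s-half t-half)
... | refl = not-reduced-inv-self s (λ s≡[] → V≢[] (cong (λ z → winv z ++ z) s≡[])) rV

telescoping : ∀ (A s B t C r D : Word) →
  ((A ++ s) ++ (winv s ++ B ++ t) ++ (winv t ++ C ++ r) ++ (winv r ++ D)) ≈ (A ++ B ++ C ++ D)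
telescoping A s B t C r D = begin
  reduce ((A ++ s) ++ (winv s ++ B ++ t) ++ Q)    ≡⟨ cong (λ z → reduce ((A ++ s) ++ z)) (++-assoc (winv s) (B ++ t) Q) ⟩
  reduce ((A ++ s) ++ winv s ++ (B ++ t) ++ Q)    ≡⟨ seam A s ((B ++ t) ++ Q) ⟩
  reduce (A ++ (B ++ t) ++ (winv t ++ C ++ r) ++ (winv r ++ D))
    ≡⟨ ≈-++ˡ A _ _ (trans (cong (λ z → reduce ((B ++ t) ++ z)) (++-assoc (winv t) (C ++ r) _)) (seam B t _)) ⟩
  reduce (A ++ B ++ (C ++ r) ++ winv r ++ D)      ≡⟨ ≈-++ˡ A _ _ (≈-++ˡ B _ _ (seam C r D)) ⟩
  reduce (A ++ B ++ C ++ D)                       ∎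
  where
  open ≡-Reasoning
  Q : Word
  Q = (winv t ++ C ++ r) ++ (winv r ++ D)

-- From 2(h + u) = 4 + 2k₁ + 2k₂ + 2k₃ with 2k₁, 2k₂ ≤ u and 2k₂, 2k₃ ≤ h
-- follows h + u ≤ 4 + 2k₂, hence h ≤ 4 and u ≤ 4.
bounded-by-four : ∀ h u k₁ k₂ k₃ → (h + u) + (h + u) ≡ 4 + (k₁ + k₁) + (k₂ + k₂) + (k₃ + k₃) →
  k₁ + k₁ ≤ u → k₂ + k₂ ≤ u → k₂ + k₂ ≤ h → k₃ + k₃ ≤ h → h ≤ 4 × u ≤ 4
bounded-by-four h u k₁ k₂ k₃ sum 2k₁≤u 2k₂≤u 2k₂≤h 2k₃≤h =
  +-cancelʳ-≤ u h 4 (≤-trans h+u≤ (+-monoʳ-≤ 4 2k₂≤u)) ,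
  +-cancelˡ-≤ h u 4 (≤-trans h+u≤ (subst (4 + (k₂ + k₂) ≤_) (+-comm 4 h) (+-monoʳ-≤ 4 2k₂≤h)))
  where
  open ≤-Reasoning
  regroup : ∀ x y z → 4 + x + y + z ≡ 4 + y + x + z
  regroup = solve-∀
  regroup' : ∀ y h u → 4 + y + u + h ≡ 4 + y + (h + u)
  regroup' = solve-∀
  h+u≤ : h + u ≤ 4 + (k₂ + k₂)
  h+u≤ = +-cancelʳ-≤ (h + u) (h + u) (4 + (k₂ + k₂)) (begin
    (h + u) + (h + u)                          ≡⟨ sum ⟩
    4 + (k₁ + k₁) + (k₂ + k₂) + (k₃ + k₃)      ≡⟨ regroup (k₁ + k₁) (k₂ + k₂) (k₃ + k₃) ⟩
    4 + (k₂ + k₂) + (k₁ + k₁) + (k₃ + k₃)      ≤⟨ +-mono-≤ (+-monoʳ-≤ (4 + (k₂ + k₂)) 2k₁≤u) 2k₃≤h ⟩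
    4 + (k₂ + k₂) + u + h                      ≡⟨ regroup' (k₂ + k₂) h u ⟩
    4 + (k₂ + k₂) + (h + u)                    ∎)

-- Write H = H₁ s₁, U = s₁⁻¹ Y₁ (cancellation in H U), U = X₂ s₂,
-- H⁻¹ = s₂⁻¹ Y₂ (in U H⁻¹) and U = X₃ s₃, H = s₃⁻¹ Y₃ (in U H).  Since no
-- move shortens the pair, each cancelled part is at most half of its word,
-- so U = s₁⁻¹ Um s₂ and H⁻¹ = s₂⁻¹ Hm s₃.  Then [H , U] reduces to the
-- reduced word H₁ Um Hm X₃⁻¹, which must be [b,a]; comparing lengths
-- gives |H| ≤ 4 and |U| ≤ 4.
module NielsenBound {H U : Word} (H-red : Reduced H) (U-red : Reduced U)
                    (comm : commutator H U ≈ [b,a]) (nielsen : NielsenReduced H U) where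

  C₁ : Cancellation H U
  C₁ = cancel-product H U H-red U-red

  C₂ : Cancellation U (winv H)
  C₂ = cancel-product U (winv H) U-red (Reduced-winv H H-red)

  C₃ : Cancellation U H
  C₃ = cancel-product U H U-red H-red

  open Cancellation C₁ renaming
    (left to H₁; common to s₁; right to Y₁; left-eq to H≡H₁s₁; right-eq to U≡s₁⁻Y₁; reduced to H₁Y₁-red)
  open Cancellation C₂ renaming
    (left to X₂; common to s₂; right to Y₂; left-eq to U≡X₂s₂; right-eq to H⁻≡s₂⁻Y₂; reduced to X₂Y₂-red)
  open Cancellation C₃ renaming
    (left to X₃; common to s₃; right to Y₃; left-eq to U≡X₃s₃; right-eq to H≡s₃⁻Y₃; reduced to X₃Y₃-red)

  length-H⁻ : length (winv H) ≡ length H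
  length-H⁻ = length-winv H

  H≡Y₂⁻s₂ : H ≡ winv Y₂ ++ s₂
  H≡Y₂⁻s₂ = trans (sym (winv-involutive H))
    (trans (cong winv H⁻≡s₂⁻Y₂) (trans (winv-++ (winv s₂) Y₂) (cong (winv Y₂ ++_) (winv-involutive s₂))))

  H⁻≡Y₃⁻s₃ : winv H ≡ winv Y₃ ++ s₃
  H⁻≡Y₃⁻s₃ = trans (cong winv H≡s₃⁻Y₃) (trans (winv-++ (winv s₃) Y₃) (cong (winv Y₃ ++_) (winv-involutive s₃)))

  s₁≤Y₁ : length s₁ ≤ length Y₁
  s₁≤Y₁ = non-shortening-left C₁ (+-cancelʳ-≤ (length U) _ _ (≮⇒≥ (nielsen H∙U)))

  s₂≤X₂ : length s₂ ≤ length X₂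
  s₂≤X₂ = non-shortening-right C₂
    (subst₂ _≤_ (sym length-H⁻) same-length (+-cancelʳ-≤ (length U) _ _ (≮⇒≥ (nielsen H∙U⁻¹))))
    where
    -- H U⁻¹ is the inverse of U H⁻¹
    same-length : length (reduce (H ++ winv U)) ≡ length (reduce (U ++ winv H))
    same-length = trans (cong (λ z → length (reduce z))
                          (sym (trans (winv-++ U (winv H)) (cong (_++ winv U) (winv-involutive H)))))
                        (length-reduce-winv (U ++ winv H))

  s₂≤Y₂ : length s₂ ≤ length Y₂
  s₂≤Y₂ = non-shortening-left C₂ (+-cancelˡ-≤ (length H) _ _ (≮⇒≥ (nielsen U∙H⁻¹)))

  s₃≤Y₃ : length s₃ ≤ length Y₃
  s₃≤Y₃ = non-shortening-left C₃ (+-cancelˡ-≤ (length H) _ _ (≮⇒≥ (nielsen U∙H)))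

  s₁-half-U : length s₁ + length s₁ ≤ length U
  s₁-half-U = double≤ (length-right-factor C₁) s₁≤Y₁

  s₂-half-U : length s₂ + length s₂ ≤ length U
  s₂-half-U = double≤' (length-left-factor C₂) s₂≤X₂

  s₂-half-H : length s₂ + length s₂ ≤ length H
  s₂-half-H = double≤ (trans (sym length-H⁻) (length-right-factor C₂)) s₂≤Y₂

  s₃-half-H : length s₃ + length s₃ ≤ length H
  s₃-half-H = double≤ (length-right-factor C₃) s₃≤Y₃

  U-overlap : Σ Word λ Um → Y₁ ≡ Um ++ s₂ × X₂ ≡ winv s₁ ++ Um
  U-overlap = common-middle (winv s₁) Y₁ X₂ s₂ (trans (sym U≡s₁⁻Y₁) U≡X₂s₂)
    (subst₂ _≤_ (cong (_+ length s₂) (sym (length-winv s₁))) (cong length U≡X₂s₂)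
      (half-sum (length s₁) (length s₂) (length U) s₁-half-U s₂-half-U))

  H⁻-overlap : Σ Word λ Hm → Y₂ ≡ Hm ++ s₃ × winv Y₃ ≡ winv s₂ ++ Hm
  H⁻-overlap = common-middle (winv s₂) Y₂ (winv Y₃) s₃ (trans (sym H⁻≡s₂⁻Y₂) H⁻≡Y₃⁻s₃)
    (subst₂ _≤_ (cong (_+ length s₃) (sym (length-winv s₂))) (trans (sym length-H⁻) (cong length H⁻≡Y₃⁻s₃))
      (half-sum (length s₂) (length s₃) (length H) s₂-half-H s₃-half-H))

  Um : Word
  Um = proj₁ U-overlap

  Hm : Word
  Hm = proj₁ H⁻-overlap

  Y₁≡Ums₂ : Y₁ ≡ Um ++ s₂
  Y₁≡Ums₂ = proj₁ (proj₂ U-overlap)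

  X₂≡s₁⁻Um : X₂ ≡ winv s₁ ++ Um
  X₂≡s₁⁻Um = proj₂ (proj₂ U-overlap)

  Y₂≡Hms₃ : Y₂ ≡ Hm ++ s₃
  Y₂≡Hms₃ = proj₁ (proj₂ H⁻-overlap)

  Y₃≡Hm⁻s₂ : Y₃ ≡ winv Hm ++ s₂
  Y₃≡Hm⁻s₂ = trans (sym (winv-involutive Y₃))
    (trans (cong winv (proj₂ (proj₂ H⁻-overlap)))
      (trans (winv-++ (winv s₂) Hm) (cong (winv Hm ++_) (winv-involutive s₂))))

  U≡s₁⁻Ums₂ : U ≡ winv s₁ ++ Um ++ s₂
  U≡s₁⁻Ums₂ = trans U≡s₁⁻Y₁ (cong (winv s₁ ++_) Y₁≡Ums₂)

  H⁻≡s₂⁻Hms₃ : winv H ≡ winv s₂ ++ Hm ++ s₃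
  H⁻≡s₂⁻Hms₃ = trans H⁻≡s₂⁻Y₂ (cong (winv s₂ ++_) Y₂≡Hms₃)

  U⁻≡s₃⁻X₃⁻ : winv U ≡ winv s₃ ++ winv X₃
  U⁻≡s₃⁻X₃⁻ = trans (cong winv U≡X₃s₃) (winv-++ X₃ s₃)

  [b,a]≉[] : ¬ ([b,a] ≈ [])
  [b,a]≉[] ()

  H≢[] : H ≢ []
  H≢[] H≡[] = [b,a]≉[] (trans (sym comm) (subst (λ z → commutator z U ≈ []) (sym H≡[]) (++-winv U)))

  U≢[] : U ≢ []
  U≢[] U≡[] = [b,a]≉[] (trans (sym comm) (subst (λ z → commutator H z ≈ []) (sym U≡[]) [H,[]]≈[]))
    where
    [H,[]]≈[] : commutator H [] ≈ []
    [H,[]]≈[] = trans (cong (λ z → reduce (H ++ z)) (++-identityʳ (winv H))) (++-winv H)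

  Um≢[] : Um ≢ []
  Um≢[] = middle-nonempty {P = H₁} {Q = winv Y₂} U-red U≢[] U≡s₁⁻Ums₂ s₁-half-U s₂-half-U (trans (sym H≡H₁s₁) H≡Y₂⁻s₂)

  Hm≢[] : Hm ≢ []
  Hm≢[] = middle-nonempty {P = X₂} {Q = X₃} (Reduced-winv H H-red) (λ H⁻≡[] → H≢[] (trans (sym (winv-involutive H)) (cong winv H⁻≡[])))
    H⁻≡s₂⁻Hms₃ (subst (length s₂ + length s₂ ≤_) (sym length-H⁻) s₂-half-H)
    (subst (length s₃ + length s₃ ≤_) (sym length-H⁻) s₃-half-H)
    (trans (sym U≡X₂s₂) U≡X₃s₃)

  -- The commutator telescopes to H₁ Um Hm X₃⁻¹, a reduced word, hence equal to [b,a].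
  core : Word
  core = H₁ ++ Um ++ Hm ++ winv X₃

  commutator≈core : commutator H U ≈ core
  commutator≈core = trans
    (cong reduce (cong₂ _++_ H≡H₁s₁ (cong₂ _++_ U≡s₁⁻Ums₂ (cong₂ _++_ H⁻≡s₂⁻Hms₃ U⁻≡s₃⁻X₃⁻))))
    (telescoping H₁ s₁ Um s₂ Hm s₃ (winv X₃))

  core-reduced : Reduced core
  core-reduced = Reduced-glue H₁ Um (Hm ++ winv X₃) H₁Um-red
                   (Reduced-glue Um Hm (winv X₃) UmHm-red HmX₃⁻-red Hm≢[]) Um≢[]
    where
    H₁Um-red : Reduced (H₁ ++ Um)
    H₁Um-red = Reduced-++ˡ (H₁ ++ Um) s₂
      (subst Reduced (sym (++-assoc H₁ Um s₂)) (subst (λ z → Reduced (H₁ ++ z)) Y₁≡Ums₂ H₁Y₁-red))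
    UmHm-red : Reduced (Um ++ Hm)
    UmHm-red = Reduced-infix (winv s₁) (Um ++ Hm) s₃ (subst Reduced X₂Y₂≡ X₂Y₂-red)
      where
      X₂Y₂≡ : X₂ ++ Y₂ ≡ winv s₁ ++ (Um ++ Hm) ++ s₃
      X₂Y₂≡ = trans (cong₂ _++_ X₂≡s₁⁻Um Y₂≡Hms₃)
                (trans (++-assoc (winv s₁) Um (Hm ++ s₃)) (cong (winv s₁ ++_) (sym (++-assoc Um Hm s₃))))
    HmX₃⁻-red : Reduced (Hm ++ winv X₃)
    HmX₃⁻-red = subst Reduced (trans (winv-++ X₃ (winv Hm)) (cong (_++ winv X₃) (winv-involutive Hm)))
      (Reduced-winv (X₃ ++ winv Hm) (Reduced-++ˡ (X₃ ++ winv Hm) s₂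
        (subst Reduced (sym (++-assoc X₃ (winv Hm) s₂)) (subst (λ z → Reduced (X₃ ++ z)) Y₃≡Hm⁻s₂ X₃Y₃-red))))

  core≡[b,a] : core ≡ [b,a]
  core≡[b,a] = trans (sym (reduced-fixed core core-reduced)) (trans (sym commutator≈core) comm)

  length-core : length H₁ + (length Um + (length Hm + length X₃)) ≡ 4
  length-core = begin
    length H₁ + (length Um + (length Hm + length X₃))
      ≡⟨ cong (λ z → length H₁ + (length Um + (length Hm + z))) (sym (length-winv X₃)) ⟩
    length H₁ + (length Um + (length Hm + length (winv X₃)))
      ≡⟨ sym (trans (length-++ H₁) (cong (length H₁ +_) (trans (length-++ Um) (cong (length Um +_) (length-++ Hm))))) ⟩
    length core
      ≡⟨ cong length core≡[b,a] ⟩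
    4 ∎
    where open ≡-Reasoning

  -- Comparing lengths: |H| = |H₁| + |s₁| = |s₂| + |Hm| + |s₃| and |U| = |s₁| + |Um| + |s₂| = |X₃| + |s₃|.
  doubled-size : (length H + length U) + (length H + length U) ≡
                 4 + (length s₁ + length s₁) + (length s₂ + length s₂) + (length s₃ + length s₃)
  doubled-size = begin
    (length H + length U) + (length H + length U)
      ≡⟨ cong₂ _+_ (cong₂ _+_ (length-left-factor C₁) |U|₁) (cong₂ _+_ |H|₂ (length-left-factor C₃)) ⟩
    ((length H₁ + length s₁) + (length s₁ + (length Um + length s₂))) +
    ((length s₂ + (length Hm + length s₃)) + (length X₃ + length s₃))
      ≡⟨ regroup (length H₁) (length Um) (length Hm) (length X₃) (length s₁) (length s₂) (length s₃) ⟩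
    (length H₁ + (length Um + (length Hm + length X₃))) +
    (length s₁ + length s₁) + (length s₂ + length s₂) + (length s₃ + length s₃)
      ≡⟨ cong (λ z → z + (length s₁ + length s₁) + (length s₂ + length s₂) + (length s₃ + length s₃)) length-core ⟩
    4 + (length s₁ + length s₁) + (length s₂ + length s₂) + (length s₃ + length s₃) ∎
    where
    open ≡-Reasoning
    regroup : ∀ A B C D k₁ k₂ k₃ → ((A + k₁) + (k₁ + (B + k₂))) + ((k₂ + (C + k₃)) + (D + k₃))
                                  ≡ (A + (B + (C + D))) + (k₁ + k₁) + (k₂ + k₂) + (k₃ + k₃)
    regroup = solve-∀
    |U|₁ : length U ≡ length s₁ + (length Um + length s₂)
    |U|₁ = trans (length-right-factor C₁) (cong (length s₁ +_) (trans (cong length Y₁≡Ums₂) (length-++ Um)))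
    |H|₂ : length H ≡ length s₂ + (length Hm + length s₃)
    |H|₂ = trans (sym length-H⁻)
             (trans (length-right-factor C₂) (cong (length s₂ +_) (trans (cong length Y₂≡Hms₃) (length-++ Hm))))

  bound : length H ≤ 4 × length U ≤ 4
  bound = bounded-by-four (length H) (length U) (length s₁) (length s₂) (length s₃)
            doubled-size s₁-half-U s₂-half-U s₂-half-H s₃-half-H

-- Boolean tests, used to check the short pairs by evaluation.

∧-elim : ∀ x y → T (x ∧ y) → T x × T y
∧-elim x y = Equivalence.to (T-∧ {x} {y})

∧-intro : ∀ x y → T x → T y → T (x ∧ y)
∧-intro x y tx ty = Equivalence.from (T-∧ {x} {y}) (tx , ty)

∨-elim : ∀ x y → T (x ∨ y) → T x ⊎ T y
∨-elim x y = Equivalence.to (T-∨ {x} {y})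

modus-ponens : ∀ x y → T (not x ∨ y) → T x → T y
modus-ponens true y ty _ = ty

_==_ : Word → Word → Bool
u == v = isYes (≡-dec _≟ₗ_ u v)

==-complete : ∀ u v → u ≡ v → T (u == v)
==-complete u v = fromWitness {a? = ≡-dec _≟ₗ_ u v}

_≈ᵇ_ : Word → Word → Bool
u ≈ᵇ v = reduce u == reduce v

≈ᵇ-sound : ∀ u v → T (u ≈ᵇ v) → u ≈ v
≈ᵇ-sound u v = toWitness {a? = ≡-dec _≟ₗ_ (reduce u) (reduce v)}

allLetters : (Letter → Bool) → Bool
allLetters q = q a ∧ q b ∧ q a⁻ ∧ q b⁻

allLetters-sound : ∀ q → T (allLetters q) → ∀ x → T (q x)
allLetters-sound q t x = pick x (∧-elim (q a) _ t)
  where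
  pick : ∀ x → T (q a) × T (q b ∧ q a⁻ ∧ q b⁻) → T (q x)
  pick a (ta , _) = ta
  pick b (_ , t') = proj₁ (∧-elim (q b) (q a⁻ ∧ q b⁻) t')
  pick a⁻ (_ , t') = proj₁ (∧-elim (q a⁻) (q b⁻) (proj₂ (∧-elim (q b) (q a⁻ ∧ q b⁻) t')))
  pick b⁻ (_ , t') = proj₂ (∧-elim (q a⁻) (q b⁻) (proj₂ (∧-elim (q b) (q a⁻ ∧ q b⁻) t')))

allWords≤ : ℕ → (Word → Bool) → Bool
allWords≤ zero p = p []
allWords≤ (suc n) p = p [] ∧ allWords≤ n (λ w → allLetters (λ x → p (x ∷ w)))

-- (The hypothesis is an equation with true so that a closed instance is
-- evaluated only once, when the computation itself is checked.)
allWords≤-sound : ∀ n p → allWords≤ n p ≡ true → ∀ w → length w ≤ n → T (p w)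
allWords≤-sound zero p t [] _ = Equivalence.from T-≡ t
allWords≤-sound (suc n) p t w |w|≤1+n
  with ∧-elim (p []) (allWords≤ n (λ w → allLetters (λ x → p (x ∷ w)))) (Equivalence.from T-≡ t)
... | t[] , tn with w | |w|≤1+n
...   | [] | _ = t[]
...   | x ∷ w' | s≤s |w'|≤n =
  allLetters-sound (λ y → p (y ∷ w')) (allWords≤-sound n _ (Equivalence.to T-≡ tn) w' |w'|≤n) x

allMoves : (Move → Bool) → Bool
allMoves q = q H∙U ∧ q H∙U⁻¹ ∧ q U∙H ∧ q U∙H⁻¹

allMoves-complete : ∀ q → (∀ m → T (q m)) → T (allMoves q)
allMoves-complete q all-q =
  ∧-intro (q H∙U) _ (all-q H∙U) (∧-intro (q H∙U⁻¹) _ (all-q H∙U⁻¹) (∧-intro (q U∙H) (q U∙H⁻¹) (all-q U∙H) (all-q U∙H⁻¹)))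

nielsenᵇ : Word → Word → Bool
nielsenᵇ H U = allMoves (λ m → isNo (shortens? m H U))

candidateᵇ : Word → Word → Bool
candidateᵇ H U = (reduce U == U) ∧ (commutator H U ≈ᵇ [b,a]) ∧ nielsenᵇ H U

candidateᵇ-complete : ∀ {H U} → Reduced U → commutator H U ≈ [b,a] → NielsenReduced H U → T (candidateᵇ H U)
candidateᵇ-complete {H} {U} U-red comm nielsen =
  ∧-intro (reduce U == U) _ (==-complete (reduce U) U (reduced-fixed U U-red))
    (∧-intro (commutator H U ≈ᵇ [b,a]) (nielsenᵇ H U) (==-complete _ _ comm)
      (allMoves-complete _ (λ m → fromWitnessFalse {a? = shortens? m H U} (nielsen m))))

solvesᵇ : Word → Word → Word → Bool
solvesᵇ H U w = (R w (b ∷ []) ≈ᵇ H) ∧ (R w (a ∷ []) ≈ᵇ U)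

solvesᵇ-sound : ∀ H U w → T (solvesᵇ H U w) → ImagePair H U
solvesᵇ-sound H U w t with ∧-elim (R w (b ∷ []) ≈ᵇ H) (R w (a ∷ []) ≈ᵇ U) t
... | tb , ta = w , ≈ᵇ-sound (R w (b ∷ [])) H tb , ≈ᵇ-sound (R w (a ∷ [])) U ta

-- The minimal pairs are (b , a), (a⁻¹ , a b) and (b a , b⁻¹), the images of
-- (b , a) under R_[], R_{b a⁻¹} and R_{a b⁻¹}.
isImagePairᵇ : Word → Word → Bool
isImagePairᵇ H U = solvesᵇ H U [] ∨ solvesᵇ H U (b ∷ a⁻ ∷ []) ∨ solvesᵇ H U (a ∷ b⁻ ∷ [])

isImagePairᵇ-sound : ∀ H U → T (isImagePairᵇ H U) → ImagePair H U
isImagePairᵇ-sound H U t with ∨-elim (solvesᵇ H U []) _ t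
... | inj₁ t₁ = solvesᵇ-sound H U [] t₁
... | inj₂ t₂ with ∨-elim (solvesᵇ H U (b ∷ a⁻ ∷ [])) (solvesᵇ H U (a ∷ b⁻ ∷ [])) t₂
...   | inj₁ t₃ = solvesᵇ-sound H U (b ∷ a⁻ ∷ []) t₃
...   | inj₂ t₄ = solvesᵇ-sound H U (a ∷ b⁻ ∷ []) t₄

short-pairᵇ : Word → Word → Bool
short-pairᵇ H U = not (candidateᵇ H U) ∨ isImagePairᵇ H U

short-pairsᵇ : Word → Bool
short-pairsᵇ H = not (reduce H == H) ∨ allWords≤ 4 (short-pairᵇ H)

short-pairs-checked : allWords≤ 4 short-pairsᵇ ≡ true
short-pairs-checked = refl

minimal-image-pair : ∀ {H U} → Reduced H → Reduced U → commutator H U ≈ [b,a] → NielsenReduced H U →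
  ImagePair H U
minimal-image-pair {H} {U} H-red U-red comm nielsen =
  isImagePairᵇ-sound H U (modus-ponens (candidateᵇ H U) _ checked (candidateᵇ-complete U-red comm nielsen))
  where
  open NielsenBound H-red U-red comm nielsen using (bound)
  checked-H : T (allWords≤ 4 (short-pairᵇ H))
  checked-H = modus-ponens (reduce H == H) (allWords≤ 4 (short-pairᵇ H))
                (allWords≤-sound 4 short-pairsᵇ short-pairs-checked H (proj₁ bound))
                (==-complete (reduce H) H (reduced-fixed H H-red))
  checked : T (short-pairᵇ H U)
  checked = allWords≤-sound 4 (short-pairᵇ H) (Equivalence.to T-≡ checked-H) U (proj₂ bound)

-- Nielsen descent: apply shortening moves until the pair is Nielsen-reduced;
-- each move is undone by appending a letter to w.
reduced-image-pair : ∀ n H U → size H U ≤ n → Reduced H → Reduced U → commutator H U ≈ [b,a] →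
  ImagePair H U
reduced-image-pair n H U size≤n H-red U-red comm with nielsen-or-shorter H U
... | inj₁ nielsen = minimal-image-pair H-red U-red comm nielsen
reduced-image-pair zero H U size≤0 H-red U-red comm | inj₂ (m , shorter) =
  ⊥-elim (n≮0 (<-≤-trans shorter size≤0))
reduced-image-pair (suc n) H U size≤1+n H-red U-red comm | inj₂ (m , shorter) =
  move-reflects m H U (reduced-image-pair n (first m H U) (second m H U) (s≤s⁻¹ (<-≤-trans shorter size≤1+n))
    (proj₁ moved-reduced) (proj₂ moved-reduced) (trans (move-commutator m H U) comm))
  where
  moved-reduced : Reduced (first m H U) × Reduced (second m H U)
  moved-reduced = move-reduced m H U H-red U-red

image-pair : ∀ H U → commutator H U ≈ [b,a] → ImagePair H U
image-pair H U comm = ImagePair-resp (reduce H) H (reduce U) U (≈-reduce H) (≈-reduce U)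
  (reduced-image-pair _ (reduce H) (reduce U) ≤-refl (reduce-reduced H) (reduce-reduced U)
    (trans (commutator-resp (reduce H) H (reduce U) U (≈-reduce H) (≈-reduce U)) comm))

theorem7p1 : (g : Word) →
    InPalImage g ⇔ Conjugate (a ∷ b ∷ g) (b ∷ a ∷ g)
theorem7p1 g = mk⇔ pal⇒conjugate conjugate⇒pal
  where
  pal⇒conjugate : InPalImage g → Conjugate (a ∷ b ∷ g) (b ∷ a ∷ g)
  pal⇒conjugate (w , Pal-w≈g) = R w (b ∷ []) , conjugation-by-image-of-b w g Pal-w≈g

  conjugate⇒pal : Conjugate (a ∷ b ∷ g) (b ∷ a ∷ g) → InPalImage g
  conjugate⇒pal (h , conj) = w ++ b⁻ ∷ [] , pal-from-image-of-a w g Rw-a≈abg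
    where
    commutator≈[b,a] : commutator h (a ∷ b ∷ g) ≈ [b,a]
    commutator≈[b,a] = trans (commutator-of-conjugate h (a ∷ b ∷ g) (b ∷ a ∷ g) conj) (bag-abg⁻¹ g)
    image : ImagePair h (a ∷ b ∷ g)
    image = image-pair h (a ∷ b ∷ g) commutator≈[b,a]
    w : Word
    w = proj₁ image
    Rw-a≈abg : R w (a ∷ []) ≈ (a ∷ b ∷ g)
    Rw-a≈abg = proj₂ (proj₂ image)
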